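{- For every $n\ge 1$, the number of equivalence classes of rooted-signed-binary trees with $n$ nodes (the root included) is the Schröder number $S_n$, where $S_1=1,S_2=2,S_3=6,\dots$ with $\sum_{n\ge1}S_nx^n=\tfrac12(1-x-\sqrt{1-6x+x^2})$.
   Context: A rooted-signed-binary tree is a finite rooted binary tree (each node has at most one left child and at most one right child, these being distinguished) in which every node other than the root is assigned a sign, $+$ or $-$; the root is unsigned. Rotations: if $c$ is the left child of a node $v$, a (right) rotation at $v$ puts $c$ in the place of $v$ (as the corresponding child of $v$'s parent, or as the root), makes $v$ the right child of $c$, and makes the former right subtree of $c$ the left subtree of $v$; the inverse operation is the symmetric (left) rotation. A rotation is allowed if either (1) $v$ is not the root and $v$ and the child $c$ rotating into its place have the same sign, or (2) $v$ is the root, in which case $c$ becomes the new unsigned root and $v$ is assigned the sign that $c$ had. Two rooted-signed-binary trees are equivalent if one can be obtained from the other by a sequence of allowed rotations. -}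

module Defs where

open import Data.Nat using (ℕ; zero; suc; _+_; _*_)
open import Data.List using (List; []; _∷_; zipWith; reverse; length)
open import Data.Nat.ListAction using (sum)
open import Data.List.Relation.Unary.All using (All)
open import Data.List.Relation.Unary.Any using (Any)
open import Data.List.Relation.Unary.AllPairs using (AllPairs)
open import Data.Product using (Σ; _×_)
open import Relation.Binary.PropositionalEquality using (_≡_)
open import Relation.Nullary using (¬_)
open import Relation.Binary.Construct.Closure.Equivalence using (EqClosure)

data Sign : Set where
  plus minus : Sign

-- Signed subtrees: every (non-root) node carries its own sign.
-- 'leaf' is the empty subtree (absent child).

data STree : Set where
  leaf : STree
  node : Sign → STree → STree → STree

data RSBTree : Set where
  root : STree → STree → RSBTree

ssize : STree → ℕ
ssize leaf = 0
ssize (node _ l r) = suc (ssize l + ssize r)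

size : RSBTree → ℕ
size (root l r) = suc (ssize l + ssize r)

-- Allowed (right) rotations, at any position.  Left rotations are the
-- inverses and are included via the symmetric closure below.

data SRot : STree → STree → Set where
  rot   : ∀ s A B C → SRot (node s (node s A B) C) (node s A (node s B C))
  left  : ∀ s {l l′} r → SRot l l′ → SRot (node s l r) (node s l′ r)
  right : ∀ s l {r r′} → SRot r r′ → SRot (node s l r) (node s l r′)

-- rotation on a whole tree: either at the root (the left child c, of
-- sign s, becomes the unsigned root, the old root gets sign s), or
-- inside one of the root's subtrees
data Rot : RSBTree → RSBTree → Set where
  rootRot : ∀ s A B C → Rot (root (node s A B) C) (root A (node s B C))
  inLeft  : ∀ {l l′} r → SRot l l′ → Rot (root l r) (root l′ r)
  inRight : ∀ l {r r′} → SRot r r′ → Rot (root l r) (root l r′)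

_≈T_ : RSBTree → RSBTree → Set
_≈T_ = EqClosure Rot

-- "The trees with n nodes fall into exactly k equivalence classes":
-- there is a list of k trees with n nodes, pairwise inequivalent, such
-- that every tree with n nodes is equivalent to one of them.

NumClasses : ℕ → ℕ → Set
NumClasses n k =
  Σ (List RSBTree) λ reps →
      length reps ≡ k
    × All (λ t → size t ≡ n) reps
    × AllPairs (λ a b → ¬ (a ≈T b)) reps
    × (∀ t → size t ≡ n → Any (λ r → t ≈T r) reps)

-- Schröder numbers S_1 = 1, S_2 = 2, S_3 = 6, S_4 = 22, ...
-- f(x) = Σ_{n≥1} S_n x^n = (1 - x - √(1-6x+x²))/2 is the power-series
-- solution (with f(0)=0) of f = x + x f + f², i.e.
--   S_n = [n = 1] + S_{n-1} + Σ_{i=1}^{n-1} S_i S_{n-i}   (S_0 = 0).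

-- next l : given l = [S_n, ..., S_1], computes S_{n+1}
next : List ℕ → ℕ
next [] = 1
next (x ∷ xs) = x + sum (zipWith _*_ (x ∷ xs) (reverse (x ∷ xs)))

table : ℕ → List ℕ
table zero = []
table (suc n) = next (table n) ∷ table n

schroder : ℕ → ℕ
schroder n with table n
... | [] = 0
... | x ∷ _ = x

-- Rotations at the root move the root's left spine into its right subtree,
-- so every tree is equivalent to one whose root has only a right subtree.
-- Below the root, a rotation reassociates a chain of equally signed nodes,
-- so a signed tree has a unique normal form in which no node has a left child
-- of its own sign; it is a complete invariant of the equivalence.  A normal
-- tree with k + 1 nodes is either a + node with empty left subtree over a
-- normal tree with k nodes, or normal trees of sizes i + j = k joined under
-- the sign opposite to that of the left one (− if the left one is empty).
-- Hence the numbers N_k of normal trees satisfy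
-- N_{k+1} = N_k + Σ_{i+j=k} N_i N_j, which is the recurrence of S_{k+1}.
module Submission where

open import Defs
open import Function using (_∘_; id; case_of_)
open import Data.Nat using (ℕ; zero; suc; _+_; _*_; _<_; _≤_; s≤s)
open import Data.Nat.Properties using (n<1+n; +-suc; +-assoc; +-identityʳ; suc-injective; m≤m+n; m≤n+m)
open import Data.Nat.Induction using (<-rec)
open import Data.Nat.ListAction using (sum)
open import Data.Maybe using (Maybe; just; nothing)
open import Data.Maybe.Properties using (just-injective)
open import Data.Product using (_×_; _,_; map₂)
open import Data.List using (List; []; _∷_; _++_; map; concat; concatMap; zip; zipWith; reverse; length; cartesianProductWith; downFrom; upTo; applyUpTo)
open import Data.List.Properties using (length-++; length-map; map-id; map-id-local; map-upTo; zip-map; zipWith-map; map-zipWith; zipWith-cong; reverse-map; reverse-downFrom)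
open import Data.List.Relation.Unary.All as All using (All; []; _∷_)
import Data.List.Relation.Unary.All.Properties as All
open import Data.List.Relation.Unary.Any as Any using (Any; here; there)
open import Data.List.Relation.Unary.AllPairs as AllPairs using (AllPairs; []; _∷_)
import Data.List.Relation.Unary.AllPairs.Properties as AllPairs
open import Data.List.Relation.Unary.Unique.Propositional using (Unique)
import Data.List.Relation.Unary.Unique.Propositional.Properties as Unique
open import Data.List.Relation.Binary.Disjoint.Propositional using (Disjoint)
open import Data.List.Membership.Propositional using (_∈_)
open import Data.List.Membership.Propositional.Properties using (∈-map⁺; ∈-++⁺ˡ; ∈-++⁺ʳ; ∈-concat⁺′; ∈-cartesianProductWith⁺)
open import Relation.Nullary using (¬_)
open import Data.Empty using (⊥)
open import Relation.Binary.PropositionalEquality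
open import Relation.Binary.Construct.Closure.ReflexiveTransitive using (ε; _◅_; _◅◅_)
open import Relation.Binary.Construct.Closure.Symmetric using (fwd; bwd)
open import Relation.Binary.Construct.Closure.Equivalence as EqClosure using (EqClosure)

private
  variable
    A B C : Set

length-concat : (xss : List (List A)) → length (concat xss) ≡ sum (map length xss)
length-concat []         = refl
length-concat (xs ∷ xss) = trans (length-++ xs) (cong (length xs +_) (length-concat xss))

length-cartesianProductWith : (f : A → B → C) (xs : List A) (ys : List B) →
                              length (cartesianProductWith f xs ys) ≡ length xs * length ys
length-cartesianProductWith f []       ys = refl
length-cartesianProductWith f (x ∷ xs) ys =
  trans (length-++ (map (f x) ys))
        (cong₂ _+_ (length-map (f x) ys) (length-cartesianProductWith f xs ys))

All-cartesianProductWith : ∀ {P : A → Set} {Q : B → Set} {R : C → Set} (f : A → B → C) {xs ys} →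
                           (∀ {x y} → P x → Q y → R (f x y)) →
                           All P xs → All Q ys → All R (cartesianProductWith f xs ys)
All-cartesianProductWith f pres []       qs = []
All-cartesianProductWith f pres (p ∷ ps) qs =
  All.++⁺ (All.map⁺ (All.map (pres p) qs)) (All-cartesianProductWith f pres ps qs)

separated⇒Disjoint : ∀ {P Q : A → Set} {xs ys} → All P xs → All Q ys →
                     (∀ {x} → P x → Q x → ⊥) → Disjoint xs ys
separated⇒Disjoint Pxs Qys P⇒¬Q (v∈xs , v∈ys) = P⇒¬Q (All.lookup Pxs v∈xs) (All.lookup Qys v∈ys)

antidiagonal : ℕ → List (ℕ × ℕ)
antidiagonal zero    = (0 , 0) ∷ []
antidiagonal (suc k) = (suc k , 0) ∷ map (map₂ suc) (antidiagonal k)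

antidiagonal-sum : ∀ k → All (λ { (i , j) → i + j ≡ k }) (antidiagonal k)
antidiagonal-sum zero    = refl ∷ []
antidiagonal-sum (suc k) =
  +-identityʳ (suc k) ∷ All.map⁺ (All.map (λ { {i , j} i+j≡k → trans (+-suc i j) (cong suc i+j≡k) })
                                          (antidiagonal-sum k))

∈-antidiagonal : ∀ i j → (i , j) ∈ antidiagonal (i + j)
∈-antidiagonal i zero    rewrite +-identityʳ i = head i
  where
  head : ∀ k → (k , 0) ∈ antidiagonal k
  head zero    = here refl
  head (suc k) = here refl
∈-antidiagonal i (suc j) rewrite +-suc i j = there (∈-map⁺ (map₂ suc) (∈-antidiagonal i j))

antidiagonal-unique : ∀ k → Unique (antidiagonal k)
antidiagonal-unique zero    = [] ∷ []
antidiagonal-unique (suc k) =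
  All.map⁺ (All.universal (λ _ ()) (antidiagonal k))
  ∷ Unique.map⁺ (λ { refl → refl }) (antidiagonal-unique k)

zip-downFrom-upTo : ∀ k → zip (downFrom (suc k)) (upTo (suc k)) ≡ antidiagonal k
zip-downFrom-upTo zero    = refl
zip-downFrom-upTo (suc k) = cong ((suc k , 0) ∷_) (begin
  zip (downFrom (suc k)) (applyUpTo suc (suc k))
    ≡⟨ cong (zip (downFrom (suc k))) (sym (map-upTo suc (suc k))) ⟩
  zip (downFrom (suc k)) (map suc (upTo (suc k)))
    ≡⟨ cong (λ ds → zip ds (map suc (upTo (suc k)))) (sym (map-id (downFrom (suc k)))) ⟩
  zip (map id (downFrom (suc k))) (map suc (upTo (suc k)))
    ≡⟨ zip-map id suc (downFrom (suc k)) (upTo (suc k)) ⟩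
  map (map₂ suc) (zip (downFrom (suc k)) (upTo (suc k)))
    ≡⟨ cong (map (map₂ suc)) (zip-downFrom-upTo k) ⟩
  map (map₂ suc) (antidiagonal k) ∎)
  where open ≡-Reasoning

rotation-size : ∀ a b c → suc (a + b) + c ≡ a + suc (b + c)
rotation-size a b c = trans (cong suc (+-assoc a b c)) (sym (+-suc a (b + c)))

SRot-size : ∀ {x y} → SRot x y → ssize x ≡ ssize y
SRot-size (rot s A B C)  = cong suc (rotation-size (ssize A) (ssize B) (ssize C))
SRot-size (left s r p)   = cong (λ n → suc (n + ssize r)) (SRot-size p)
SRot-size (right s l p)  = cong (λ n → suc (ssize l + n)) (SRot-size p)

Rot-size : ∀ {x y} → Rot x y → size x ≡ size y
Rot-size (rootRot s A B C) = cong suc (rotation-size (ssize A) (ssize B) (ssize C))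
Rot-size (inLeft r p)      = cong (λ n → suc (n + ssize r)) (SRot-size p)
Rot-size (inRight l p)     = cong (λ n → suc (ssize l + n)) (SRot-size p)

≈T-size : ∀ {x y} → x ≈T y → size x ≡ size y
≈T-size = EqClosure.gfold isEquivalence size Rot-size

_~_ : STree → STree → Set
_~_ = EqClosure SRot

node-congˡ : ∀ s r {l l′} → l ~ l′ → node s l r ~ node s l′ r
node-congˡ s r = EqClosure.gmap (λ l → node s l r) (left s r)

node-congʳ : ∀ s l {r r′} → r ~ r′ → node s l r ~ node s l r′
node-congʳ s l = EqClosure.gmap (node s l) (right s l)

unwind : STree → STree → STree
unwind leaf         r = r
unwind (node s A B) r = unwind A (node s B r)

root≈unwind : ∀ l r → root l r ≈T root leaf (unwind l r)
root≈unwind leaf         r = ε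
root≈unwind (node s A B) r = fwd (rootRot s A B r) ◅ root≈unwind A (node s B r)

unwind-SRotʳ : ∀ l {x y} → SRot x y → SRot (unwind l x) (unwind l y)
unwind-SRotʳ leaf         p = p
unwind-SRotʳ (node s A B) p = unwind-SRotʳ A (right s B p)

unwind-SRotˡ : ∀ {l l′} → SRot l l′ → ∀ r → unwind l r ~ unwind l′ r
unwind-SRotˡ (rot s A B C) r = bwd (unwind-SRotʳ A (rot s B C r)) ◅ ε
unwind-SRotˡ (left s C p)  r = unwind-SRotˡ p (node s C r)
unwind-SRotˡ (right s A p) r = fwd (unwind-SRotʳ A (left s r p)) ◅ ε

-- The normal form of node s x y, provided x and y are normal.
normNode : Sign → STree → STree → STree
normNode plus  leaf              y = node plus leaf y
normNode plus  (node plus a b)   y = node plus a (normNode plus b y)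
normNode plus  (node minus a b)  y = node plus (node minus a b) y
normNode minus leaf              y = node minus leaf y
normNode minus (node minus a b)  y = node minus a (normNode minus b y)
normNode minus (node plus a b)   y = node minus (node plus a b) y

normalise : STree → STree
normalise leaf         = leaf
normalise (node s l r) = normNode s (normalise l) (normalise r)

nf : RSBTree → STree
nf (root l r) = normalise (unwind l r)

node~normNode : ∀ s x y → node s x y ~ normNode s x y
node~normNode plus  leaf             y = ε
node~normNode plus  (node plus a b)  y = fwd (rot plus a b y) ◅ node-congʳ plus a (node~normNode plus b y)
node~normNode plus  (node minus a b) y = ε
node~normNode minus leaf             y = ε
node~normNode minus (node minus a b) y = fwd (rot minus a b y) ◅ node-congʳ minus a (node~normNode minus b y)
node~normNode minus (node plus a b)  y = ε

~normalise : ∀ x → x ~ normalise x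
~normalise leaf         = ε
~normalise (node s l r) =
  node-congˡ s r (~normalise l) ◅◅ node-congʳ s (normalise l) (~normalise r)
  ◅◅ node~normNode s (normalise l) (normalise r)

≈root-nf : ∀ t → t ≈T root leaf (nf t)
≈root-nf (root l r) =
  root≈unwind l r ◅◅ EqClosure.gmap (root leaf) (inRight leaf) (~normalise (unwind l r))

normNode-assoc : ∀ s x y z → normNode s (normNode s x y) z ≡ normNode s x (normNode s y z)
normNode-assoc plus  leaf             y z = refl
normNode-assoc plus  (node plus a b)  y z = cong (node plus a) (normNode-assoc plus b y z)
normNode-assoc plus  (node minus a b) y z = refl
normNode-assoc minus leaf             y z = refl
normNode-assoc minus (node minus a b) y z = cong (node minus a) (normNode-assoc minus b y z)
normNode-assoc minus (node plus a b)  y z = refl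

normalise-SRot : ∀ {x y} → SRot x y → normalise x ≡ normalise y
normalise-SRot (rot s A B C) = normNode-assoc s (normalise A) (normalise B) (normalise C)
normalise-SRot (left s r p)  = cong (λ z → normNode s z (normalise r)) (normalise-SRot p)
normalise-SRot (right s l p) = cong (normNode s (normalise l)) (normalise-SRot p)

normalise-resp-~ : ∀ {x y} → x ~ y → normalise x ≡ normalise y
normalise-resp-~ = EqClosure.gfold isEquivalence normalise normalise-SRot

nf-Rot : ∀ {x y} → Rot x y → nf x ≡ nf y
nf-Rot (rootRot s A B C)   = refl
nf-Rot (inLeft r p)        = normalise-resp-~ (unwind-SRotˡ p r)
nf-Rot (inRight l p)       = normalise-SRot (unwind-SRotʳ l p)

nf-resp-≈T : ∀ {x y} → x ≈T y → nf x ≡ nf y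
nf-resp-≈T = EqClosure.gfold isEquivalence nf nf-Rot

data OtherSign : Sign → STree → Set where
  empty      : ∀ {s} → OtherSign s leaf
  plus≠minus : ∀ {l r} → OtherSign plus (node minus l r)
  minus≠plus : ∀ {l r} → OtherSign minus (node plus l r)

data Normal : STree → Set where
  leaf : Normal leaf
  node : ∀ {s l r} → OtherSign s l → Normal l → Normal r → Normal (node s l r)

normNode-Normal : ∀ s {x y} → Normal x → Normal y → Normal (normNode s x y)
normNode-Normal plus  leaf                     ny = node empty leaf ny
normNode-Normal plus  (node {plus}  o na nb)   ny = node o na (normNode-Normal plus nb ny)
normNode-Normal plus  (node {minus} o na nb)   ny = node plus≠minus (node o na nb) ny
normNode-Normal minus leaf                     ny = node empty leaf ny
normNode-Normal minus (node {minus} o na nb)   ny = node o na (normNode-Normal minus nb ny)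
normNode-Normal minus (node {plus}  o na nb)   ny = node minus≠plus (node o na nb) ny

normalise-Normal : ∀ x → Normal (normalise x)
normalise-Normal leaf         = leaf
normalise-Normal (node s l r) = normNode-Normal s (normalise-Normal l) (normalise-Normal r)

nf-Normal : ∀ t → Normal (nf t)
nf-Normal (root l r) = normalise-Normal (unwind l r)

normalise-Normal-id : ∀ {u} → Normal u → normalise u ≡ u
normalise-Normal-id leaf = refl
normalise-Normal-id (node {s} {l} {r} o nl nr)
  rewrite normalise-Normal-id nl | normalise-Normal-id nr = normNode-OtherSign o
  where
  normNode-OtherSign : ∀ {s l} → OtherSign s l → normNode s l r ≡ node s l r
  normNode-OtherSign {plus}  empty      = refl
  normNode-OtherSign {minus} empty      = refl
  normNode-OtherSign         plus≠minus = refl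
  normNode-OtherSign         minus≠plus = refl

opposite : STree → Sign
opposite leaf             = minus
opposite (node plus _ _)  = minus
opposite (node minus _ _) = plus

oppNode : STree → STree → STree
oppNode l r = node (opposite l) l r

oppNode-OtherSign : ∀ l → OtherSign (opposite l) l
oppNode-OtherSign leaf             = empty
oppNode-OtherSign (node plus _ _)  = minus≠plus
oppNode-OtherSign (node minus _ _) = plus≠minus

oppNode-injective : ∀ {w x y z} → oppNode w y ≡ oppNode x z → w ≡ x × y ≡ z
oppNode-injective refl = refl , refl

-- Takes distinct values on the distinct blocks of normals-suc.
shape : STree → Maybe (ℕ × ℕ)
shape leaf                = nothing
shape (node plus leaf _)  = nothing
shape (node s l r)        = just (ssize l , ssize r)

shape-oppNode : ∀ l r → shape (oppNode l r) ≡ just (ssize l , ssize r)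
shape-oppNode leaf             r = refl
shape-oppNode (node plus _ _)  r = refl
shape-oppNode (node minus _ _) r = refl

-- Mirrors next: from the lists of normal trees with k, ..., 0 nodes, lists those with k + 1.
normalsNext : List (List STree) → List STree
normalsNext []         = leaf ∷ []
normalsNext (xs ∷ xss) =
  map (node plus leaf) xs
  ++ concat (zipWith (cartesianProductWith oppNode) (xs ∷ xss) (reverse (xs ∷ xss)))

normalsTable : ℕ → List (List STree)
normalsTable zero    = []
normalsTable (suc k) = normalsNext (normalsTable k) ∷ normalsTable k

normals : ℕ → List STree
normals k = normalsNext (normalsTable k)

length-normalsNext : ∀ xss → length (normalsNext xss) ≡ next (map length xss)
length-normalsNext []         = refl
length-normalsNext (xs ∷ xss) = begin
  length (map (node plus leaf) xs ++ concat (zipWith cp yss (reverse yss)))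
    ≡⟨ length-++ (map (node plus leaf) xs) ⟩
  length (map (node plus leaf) xs) + length (concat (zipWith cp yss (reverse yss)))
    ≡⟨ cong₂ _+_ (length-map (node plus leaf) xs) (length-concat (zipWith cp yss (reverse yss))) ⟩
  length xs + sum (map length (zipWith cp yss (reverse yss)))
    ≡⟨ cong (λ n → length xs + sum n) (begin
         map length (zipWith cp yss (reverse yss))
           ≡⟨ map-zipWith cp length yss (reverse yss) ⟩
         zipWith (λ as bs → length (cp as bs)) yss (reverse yss)
           ≡⟨ zipWith-cong (length-cartesianProductWith oppNode) yss (reverse yss) ⟩
         zipWith (λ as bs → length as * length bs) yss (reverse yss)
           ≡⟨ sym (zipWith-map _*_ length length yss (reverse yss)) ⟩
         zipWith _*_ (map length yss) (map length (reverse yss))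
           ≡⟨ cong (zipWith _*_ (map length yss)) (reverse-map length yss) ⟩
         zipWith _*_ (map length yss) (reverse (map length yss)) ∎) ⟩
  next (map length yss) ∎
  where
  open ≡-Reasoning
  yss = xs ∷ xss
  cp = cartesianProductWith oppNode

map-length-normalsTable : ∀ k → map length (normalsTable k) ≡ table k
map-length-normalsTable zero    = refl
map-length-normalsTable (suc k) =
  cong₂ _∷_ (trans (length-normalsNext (normalsTable k)) (cong next (map-length-normalsTable k)))
            (map-length-normalsTable k)

length-normals : ∀ k → length (normals k) ≡ schroder (suc k)
length-normals k = trans (length-normalsNext (normalsTable k)) (cong next (map-length-normalsTable k))

block : ℕ × ℕ → List STree
block (i , j) = cartesianProductWith oppNode (normals i) (normals j)

normalsTable-downFrom : ∀ k → normalsTable k ≡ map normals (downFrom k)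
normalsTable-downFrom zero    = refl
normalsTable-downFrom (suc k) = cong (normals k ∷_) (normalsTable-downFrom k)

normals-suc : ∀ k → normals (suc k) ≡ map (node plus leaf) (normals k) ++ concatMap block (antidiagonal k)
normals-suc k = cong (λ bs → map (node plus leaf) (normals k) ++ concat bs) (begin
  zipWith cp (normalsTable (suc k)) (reverse (normalsTable (suc k)))
    ≡⟨ cong (λ t → zipWith cp t (reverse t)) (normalsTable-downFrom (suc k)) ⟩
  zipWith cp (map normals ds) (reverse (map normals ds))
    ≡⟨ cong (zipWith cp (map normals ds)) (sym (reverse-map normals ds)) ⟩
  zipWith cp (map normals ds) (map normals (reverse ds))
    ≡⟨ cong (λ us → zipWith cp (map normals ds) (map normals us)) (reverse-downFrom (suc k)) ⟩
  zipWith cp (map normals ds) (map normals (upTo (suc k)))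
    ≡⟨ zipWith-map cp normals normals ds (upTo (suc k)) ⟩
  zipWith (λ i j → block (i , j)) ds (upTo (suc k))
    ≡⟨ sym (map-zipWith _,_ block ds (upTo (suc k))) ⟩
  map block (zip ds (upTo (suc k)))
    ≡⟨ cong (map block) (zip-downFrom-upTo k) ⟩
  map block (antidiagonal k) ∎)
  where
  open ≡-Reasoning
  ds = downFrom (suc k)
  cp = cartesianProductWith oppNode

antidiagonal-bounds : ∀ {i j k} → i + j ≡ k → i < suc k × j < suc k
antidiagonal-bounds {i} {j} refl = s≤s (m≤m+n i j) , s≤s (m≤n+m j i)

All-normals : (P : ℕ → STree → Set) → P 0 leaf →
              (∀ {k t} → P k t → P (suc k) (node plus leaf t)) →
              (∀ {i j l r} → P i l → P j r → P (suc (i + j)) (oppNode l r)) →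
              ∀ k → All (P k) (normals k)
All-normals P P-leaf P-plusLeaf P-oppNode = <-rec (λ k → All (P k) (normals k)) step
  where
  step : ∀ k → (∀ {i} → i < k → All (P i) (normals i)) → All (P k) (normals k)
  step zero    _   = P-leaf ∷ []
  step (suc k) rec = subst (All (P (suc k))) (sym (normals-suc k))
    (All.++⁺ (All.map⁺ (All.map P-plusLeaf (rec (n<1+n k))))
             (All.concat⁺ (All.map⁺ (All.map (λ { {i , j} → block-P {i} {j} }) (antidiagonal-sum k)))))
    where
    block-P : ∀ {i j} → i + j ≡ k → All (P (suc k)) (block (i , j))
    block-P {i} {j} i+j≡k =
      let i< , j< = antidiagonal-bounds {i} {j} i+j≡k in
      subst (λ n → All (P (suc n)) (block (i , j))) i+j≡k
            (All-cartesianProductWith oppNode P-oppNode (rec i<) (rec j<))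

normals-size : ∀ k → All (λ t → ssize t ≡ k) (normals k)
normals-size = All-normals (λ k t → ssize t ≡ k) refl (cong suc) (cong₂ (λ a b → suc (a + b)))

normals-Normal : ∀ k → All Normal (normals k)
normals-Normal = All-normals (λ _ → Normal) leaf (node empty leaf)
                             (λ {l = l} nl nr → node (oppNode-OtherSign l) nl nr)

block-shape : ∀ p → All (λ t → shape t ≡ just p) (block p)
block-shape (i , j) =
  All-cartesianProductWith oppNode
    (λ {l} {r} sl sr → trans (shape-oppNode l r) (cong₂ (λ a b → just (a , b)) sl sr))
    (normals-size i) (normals-size j)

normals-unique : ∀ k → Unique (normals k)
normals-unique = <-rec (Unique ∘ normals) step
  where
  step : ∀ k → (∀ {i} → i < k → Unique (normals i)) → Unique (normals k)
  step zero    _   = [] ∷ []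
  step (suc k) rec = subst Unique (sym (normals-suc k))
    (Unique.++⁺ (Unique.map⁺ (λ { refl → refl }) (rec (n<1+n k)))
                (Unique.concat⁺ (All.map⁺ (All.map (λ { {i , j} → block-unique {i} {j} }) (antidiagonal-sum k)))
                                (AllPairs.map⁺ (AllPairs.map blocks-disjoint (antidiagonal-unique k))))
                (separated⇒Disjoint plusLeaf-shape blocks-shape (λ sh≡nothing sh≢nothing → sh≢nothing sh≡nothing)))
    where
    block-unique : ∀ {i j} → i + j ≡ k → Unique (block (i , j))
    block-unique {i} {j} i+j≡k =
      let i< , j< = antidiagonal-bounds {i} {j} i+j≡k in
      Unique.cartesianProductWith⁺ oppNode oppNode-injective (rec i<) (rec j<)

    blocks-disjoint : ∀ {p q} → p ≢ q → Disjoint (block p) (block q)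
    blocks-disjoint {p} {q} p≢q =
      separated⇒Disjoint (block-shape p) (block-shape q) (λ sp sq → p≢q (just-injective (trans (sym sp) sq)))

    plusLeaf-shape : All (λ t → shape t ≡ nothing) (map (node plus leaf) (normals k))
    plusLeaf-shape = All.map⁺ (All.universal (λ _ → refl) (normals k))

    blocks-shape : All (λ t → shape t ≢ nothing) (concatMap block (antidiagonal k))
    blocks-shape = All.concat⁺ (All.map⁺ (All.universal
      (λ p → All.map (λ { sh≡just sh≡nothing → case trans (sym sh≡just) sh≡nothing of λ () }) (block-shape p))
      (antidiagonal k)))

normals-complete : ∀ {u} → Normal u → u ∈ normals (ssize u)
oppNode∈normals : ∀ {l r} → Normal l → Normal r → oppNode l r ∈ normals (suc (ssize l + ssize r))

normals-complete leaf                       = here refl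
normals-complete (node {plus} {r = r} empty nl nr) =
  subst (node plus leaf r ∈_) (sym (normals-suc (ssize r))) (∈-++⁺ˡ (∈-map⁺ (node plus leaf) (normals-complete nr)))
normals-complete (node {minus} empty nl nr) = oppNode∈normals nl nr
normals-complete (node plus≠minus nl nr)    = oppNode∈normals nl nr
normals-complete (node minus≠plus nl nr)    = oppNode∈normals nl nr

oppNode∈normals {l} {r} nl nr =
  subst (oppNode l r ∈_) (sym (normals-suc (ssize l + ssize r)))
    (∈-++⁺ʳ _ (∈-concat⁺′ (∈-cartesianProductWith⁺ oppNode (normals-complete nl) (normals-complete nr))
                          (∈-map⁺ block (∈-antidiagonal (ssize l) (ssize r)))))

normals-inequivalent : ∀ k → AllPairs (λ a b → ¬ a ≈T b) (map (root leaf) (normals k))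
normals-inequivalent k =
  AllPairs.map⁺ (AllPairs.map (λ u≢v u≈v → u≢v (nf-resp-≈T u≈v)) (AllPairs.map⁻ normalised-unique))
  where
  normalised-unique : Unique (map normalise (normals k))
  normalised-unique = subst Unique (sym (map-id-local (All.map normalise-Normal-id (normals-Normal k))))
                            (normals-unique k)

normals-cover : ∀ k t → size t ≡ suc k → Any (t ≈T_) (map (root leaf) (normals k))
normals-cover k t size≡ = Any.map (λ e → subst (t ≈T_) e (≈root-nf t)) (∈-map⁺ (root leaf) nf∈normals)
  where
  nf∈normals : nf t ∈ normals k
  nf∈normals = subst (λ n → nf t ∈ normals n) (suc-injective (trans (sym (≈T-size (≈root-nf t))) size≡))
                     (normals-complete (nf-Normal t))

mainTheorem4 : ∀ (n : ℕ) → 1 ≤ n → NumClasses n (schroder n)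
mainTheorem4 (suc k) _ =
  map (root leaf) (normals k) ,
  trans (length-map (root leaf) (normals k)) (length-normals k) ,
  All.map⁺ (All.map (cong suc) (normals-size k)) ,
  normals-inequivalent k ,
  normals-cover k
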